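{- Let $G\neq1$ be a finite abelian group, $R,L\subseteq G$ with $R=R^{ -1}$, $L=L^{ -1}$, $1\notin R\cup L$, $|R|=2$ and $|L|=1$, and let $\Gamma=\mathrm{SC}(G;R,L,\{1\})$ be connected. Then $\Gamma$ is normal.
   Context: $\mathrm{SC}(G;R,L,\{1\})$ is the graph with vertex set $G\times\{1,2\}$ and edges $\{(x,1),(y,1)\}$ for $yx^{ -1}\in R$, $\{(x,2),(y,2)\}$ for $yx^{ -1}\in L$, and $\{(x,1),(x,2)\}$ for $x\in G$. $R_G=\{\rho_g\mid g\in G\}$ where $(x,i)^{\rho_g}=(xg,i)$; $\Gamma$ is normal if $R_G\trianglelefteq\mathrm{Aut}(\Gamma)$. -}

module Defs where

open import Level using (Level; _⊔_)
open import Algebra.Bundles using (AbelianGroup)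
open import Data.Nat using (ℕ)
open import Data.Fin using (Fin)
open import Data.Product using (Σ; ∃; _×_; _,_)
open import Data.Sum using (_⊎_)
open import Relation.Nullary using (¬_)
open import Relation.Unary using (Pred)
open import Relation.Binary.Definitions using (Decidable)
open import Relation.Binary.PropositionalEquality using (_≡_)
open import Function.Bundles using (_⇔_)

data Layer : Set where
  one two : Layer

module _ {c ℓ : Level} (G : AbelianGroup c ℓ) where
  open AbelianGroup G

  IsFinite : Set (c ⊔ ℓ)
  IsFinite = (Σ ℕ λ n → Σ (Fin n → Carrier) λ f → ∀ x → ∃ λ i → f i ≈ x)
             × Decidable _≈_

  Nontrivial : Set (c ⊔ ℓ)
  Nontrivial = ∃ λ x → ¬ (x ≈ ε)

  module _ {p : Level} where
    InvClosed : Pred Carrier p → Set (c ⊔ p)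
    InvClosed S = ∀ x → S x → S (x ⁻¹)

    HasSize2 : Pred Carrier p → Set (c ⊔ ℓ ⊔ p)
    HasSize2 S = ∃ λ a → ∃ λ b → ¬ (a ≈ b) × (∀ x → S x ⇔ (x ≈ a ⊎ x ≈ b))

    HasSize1 : Pred Carrier p → Set (c ⊔ ℓ ⊔ p)
    HasSize1 S = ∃ λ a → ∀ x → S x ⇔ (x ≈ a)

  module SC {p : Level} (R L : Pred Carrier p) where

    Vertex : Set c
    Vertex = Carrier × Layer

    _≈ᵥ_ : Vertex → Vertex → Set ℓ
    (x , i) ≈ᵥ (y , j) = (x ≈ y) × (i ≡ j)

    Adj : Vertex → Vertex → Set (ℓ ⊔ p)
    Adj (x , one) (y , one) = Level.Lift ℓ (R (y ∙ x ⁻¹))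
    Adj (x , two) (y , two) = Level.Lift ℓ (L (y ∙ x ⁻¹))
    Adj (x , one) (y , two) = Level.Lift p (x ≈ y)
    Adj (x , two) (y , one) = Level.Lift p (x ≈ y)

    data Walk : Vertex → Vertex → Set (c ⊔ ℓ ⊔ p) where
      here : ∀ {u v} → u ≈ᵥ v → Walk u v
      step : ∀ {u w v} → Adj u w → Walk w v → Walk u v

    Connected : Set (c ⊔ ℓ ⊔ p)
    Connected = ∀ u v → Walk u v

    record Automorphism : Set (c ⊔ ℓ ⊔ p) where
      field
        to       : Vertex → Vertex
        from     : Vertex → Vertex
        to-cong  : ∀ {u v} → u ≈ᵥ v → to u ≈ᵥ to v
        from-cong : ∀ {u v} → u ≈ᵥ v → from u ≈ᵥ from v
        from-to  : ∀ v → from (to v) ≈ᵥ v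
        to-from  : ∀ v → to (from v) ≈ᵥ v
        adj-pres : ∀ u v → Adj u v → Adj (to u) (to v)
        adj-refl : ∀ u v → Adj (to u) (to v) → Adj u v

    ρ : Carrier → Vertex → Vertex
    ρ g (x , i) = (x ∙ g , i)

    -- Γ is normal: R_G ⊴ Aut(Γ), i.e. σ⁻¹ ρ_g σ ∈ R_G for all σ ∈ Aut(Γ), g ∈ G
    -- (maps act on the right: v^{σ⁻¹ ρ_g σ} = σ(ρ_g(σ⁻¹ v))).
    Normal : Set (c ⊔ ℓ ⊔ p)
    Normal = ∀ (σ : Automorphism) (g : Carrier) → ∃ λ h →
               ∀ v → Automorphism.to σ (ρ g (Automorphism.from σ v)) ≈ᵥ ρ h v

-- An automorphism σ of Γ must fix the layers: a vertex (x,1) has the three distinct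
-- neighbours (xa,1), (xb,1), (x,2), while a vertex (y,2) has at most the two
-- neighbours (y,1), (ly,2). Since the matching edges {(x,1),(x,2)} are then also
-- preserved, σ(x,i) = (s x, i) for a bijection s of G. Put δ x t = s(xt) s(x)⁻¹;
-- this is a cocycle, δ x maps R injectively into R and fixes l. On the two-element
-- set R this forces δ (xu) t = δ x t for all generators t, u, and by connectedness
-- δ x t does not depend on x, first for generators t and then, by the cocycle
-- identity, for all t. Hence s(xg) = s(x) h with h = δ 1 g, i.e. σ ρ_g σ⁻¹ = ρ_h.
module Submission where

open import Defs
open import Level using (Level; lift; lower)
open import Algebra.Bundles using (AbelianGroup)
import Algebra.Properties.AbelianGroup as AbelianGroupProperties
open import Data.Empty using (⊥-elim)
open import Data.Product using (_,_; proj₁; proj₂)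
open import Data.Product.Relation.Binary.Pointwise.NonDependent using (×-setoid)
open import Data.Sum using (_⊎_; inj₁; inj₂)
import Data.Sum as Sum
open import Function.Base using (_∘_)
open import Function.Bundles using (Equivalence; _⇔_)
open import Relation.Binary.Bundles using (Setoid)
open import Relation.Binary.Definitions using (Decidable)
import Relation.Binary.PropositionalEquality as ≡
open import Relation.Nullary using (¬_; yes; no)
open import Relation.Unary using (Pred; _∪_)

module _ {a ℓ : Level} (S : Setoid a ℓ) where
  open Setoid S

  pair-pigeonhole : ∀ {A B x y z} → x ≈ A ⊎ x ≈ B → y ≈ A ⊎ y ≈ B → z ≈ A ⊎ z ≈ B →
                    ¬ x ≈ z → ¬ y ≈ z → x ≈ y
  pair-pigeonhole (inj₁ x≈A) (inj₁ y≈A) _          _   _   = trans x≈A (sym y≈A)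
  pair-pigeonhole (inj₂ x≈B) (inj₂ y≈B) _          _   _   = trans x≈B (sym y≈B)
  pair-pigeonhole (inj₁ x≈A) (inj₂ _)   (inj₁ z≈A) x≉z _   = ⊥-elim (x≉z (trans x≈A (sym z≈A)))
  pair-pigeonhole (inj₁ _)   (inj₂ y≈B) (inj₂ z≈B) _   y≉z = ⊥-elim (y≉z (trans y≈B (sym z≈B)))
  pair-pigeonhole (inj₂ _)   (inj₁ y≈A) (inj₁ z≈A) _   y≉z = ⊥-elim (y≉z (trans y≈A (sym z≈A)))
  pair-pigeonhole (inj₂ x≈B) (inj₁ _)   (inj₂ z≈B) x≉z _   = ⊥-elim (x≉z (trans x≈B (sym z≈B)))

module _ {c ℓ : Level} (G : AbelianGroup c ℓ) where
  open AbelianGroup G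
  open AbelianGroupProperties G
    using (//-rightDividesˡ; xyx⁻¹≈y; inverseˡ-unique; ⁻¹-involutive; ∙-cancelˡ; ∙-cancelʳ)
  open import Relation.Binary.Reasoning.Setoid setoid

  module Pair {p : Level} {S : Pred Carrier p} (S-size : HasSize2 G S) where
    A B : Carrier
    A = proj₁ S-size
    B = proj₁ (proj₂ S-size)

    A≉B : ¬ A ≈ B
    A≉B = proj₁ (proj₂ (proj₂ S-size))

    private
      S⇔pair : ∀ x → S x ⇔ (x ≈ A ⊎ x ≈ B)
      S⇔pair = proj₂ (proj₂ (proj₂ S-size))

      ∈-pair : ∀ {x} → S x → x ≈ A ⊎ x ≈ B
      ∈-pair {x} = Equivalence.to (S⇔pair x)

    S-A : S A
    S-A = Equivalence.from (S⇔pair A) (inj₁ refl)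

    S-B : S B
    S-B = Equivalence.from (S⇔pair B) (inj₂ refl)

    S-resp : ∀ {x y} → x ≈ y → S x → S y
    S-resp {y = y} x≈y Sx =
      Equivalence.from (S⇔pair y) (Sum.map (trans (sym x≈y)) (trans (sym x≈y)) (∈-pair Sx))

    S-pigeonhole : ∀ {x y z} → S x → S y → S z → ¬ x ≈ z → ¬ y ≈ z → x ≈ y
    S-pigeonhole Sx Sy Sz = pair-pigeonhole setoid (∈-pair Sx) (∈-pair Sy) (∈-pair Sz)

    module _ (S-inv : InvClosed G S) (_≟_ : Decidable _≈_) where

      self-inverse-uniform : ∀ {u v} → S u → S v → u ⁻¹ ≈ u → v ⁻¹ ≈ v
      self-inverse-uniform {u} {v} Su Sv u⁻¹≈u with (v ⁻¹) ≟ v | u ≟ v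
      ... | yes v⁻¹≈v | _       = v⁻¹≈v
      ... | no _      | yes u≈v = begin
        v ⁻¹  ≈⟨ ⁻¹-cong u≈v ⟨
        u ⁻¹  ≈⟨ u⁻¹≈u ⟩
        u     ≈⟨ u≈v ⟩
        v     ∎
      ... | no v⁻¹≉v  | no u≉v  = begin
        v ⁻¹         ≈⟨ u≈v⁻¹ ⟨
        u            ≈⟨ u⁻¹≈u ⟨
        u ⁻¹         ≈⟨ ⁻¹-cong u≈v⁻¹ ⟩
        v ⁻¹ ⁻¹      ≈⟨ ⁻¹-involutive v ⟩
        v            ∎
        where
          u≈v⁻¹ : u ≈ v ⁻¹
          u≈v⁻¹ = S-pigeonhole Su (S-inv v Sv) Sv u≉v v⁻¹≉v

      injection-commutes-with-⁻¹ : (f : Carrier → Carrier) →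
        (∀ {x y} → x ≈ y → f x ≈ f y) → (∀ {x y} → f x ≈ f y → x ≈ y) →
        (∀ {x} → S x → S (f x)) → ∀ {u} → S u → f (u ⁻¹) ≈ f u ⁻¹
      injection-commutes-with-⁻¹ f f-cong f-inj f-S {u} Su with (u ⁻¹) ≟ u
      ... | yes u⁻¹≈u = trans (f-cong u⁻¹≈u) (sym (self-inverse-uniform Su (f-S Su) u⁻¹≈u))
      ... | no u⁻¹≉u  = S-pigeonhole (f-S (S-inv u Su)) (S-inv _ (f-S Su)) (f-S Su)
                          (u⁻¹≉u ∘ f-inj) (u⁻¹≉u ∘ self-inverse-uniform (f-S Su) Su)

  module Difference (s : Carrier → Carrier)
                    (s-cong : ∀ {x y} → x ≈ y → s x ≈ s y)
                    (s-injective : ∀ {x y} → s x ≈ s y → x ≈ y) where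

    δ : Carrier → Carrier → Carrier
    δ x t = s (x ∙ t) ∙ s x ⁻¹

    δ-cong : ∀ {x x′ t t′} → x ≈ x′ → t ≈ t′ → δ x t ≈ δ x′ t′
    δ-cong x≈x′ t≈t′ = ∙-cong (s-cong (∙-cong x≈x′ t≈t′)) (⁻¹-cong (s-cong x≈x′))

    δ-split : ∀ x t → s (x ∙ t) ≈ δ x t ∙ s x
    δ-split x t = sym (//-rightDividesˡ (s x) (s (x ∙ t)))

    δ-cocycle : ∀ x t u → δ x (t ∙ u) ≈ δ (x ∙ t) u ∙ δ x t
    δ-cocycle x t u = begin
      s (x ∙ (t ∙ u)) ∙ s x ⁻¹                                 ≈⟨ ∙-congʳ (s-cong (assoc x t u)) ⟨
      s (x ∙ t ∙ u) ∙ s x ⁻¹                                   ≈⟨ ∙-congʳ (//-rightDividesˡ (s (x ∙ t)) _) ⟨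
      s (x ∙ t ∙ u) ∙ s (x ∙ t) ⁻¹ ∙ s (x ∙ t) ∙ s x ⁻¹        ≈⟨ assoc _ (s (x ∙ t)) (s x ⁻¹) ⟩
      s (x ∙ t ∙ u) ∙ s (x ∙ t) ⁻¹ ∙ (s (x ∙ t) ∙ s x ⁻¹)      ∎

    δ-identity : ∀ x → δ x ε ≈ ε
    δ-identity x = trans (∙-congʳ (s-cong (identityʳ x))) (inverseʳ (s x))

    δ-inverse : ∀ x t → δ (x ∙ t) (t ⁻¹) ≈ δ x t ⁻¹
    δ-inverse x t = inverseˡ-unique _ _ (begin
      δ (x ∙ t) (t ⁻¹) ∙ δ x t  ≈⟨ δ-cocycle x t (t ⁻¹) ⟨
      δ x (t ∙ t ⁻¹)            ≈⟨ δ-cong refl (inverseʳ t) ⟩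
      δ x ε                     ≈⟨ δ-identity x ⟩
      ε                         ∎)

    δ-injective : ∀ {x t u} → δ x t ≈ δ x u → t ≈ u
    δ-injective {x} {t} {u} = ∙-cancelˡ x t u ∘ s-injective ∘ ∙-cancelʳ (s x ⁻¹) _ _

    δ-swap : ∀ {x t u} → δ (x ∙ t) u ≈ δ x u → δ (x ∙ u) t ≈ δ x t
    δ-swap {x} {t} {u} hyp = ∙-cancelʳ (δ x u) _ _ (begin
      δ (x ∙ u) t ∙ δ x u  ≈⟨ δ-cocycle x u t ⟨
      δ x (u ∙ t)          ≈⟨ δ-cong refl (comm u t) ⟩
      δ x (t ∙ u)          ≈⟨ δ-cocycle x t u ⟩
      δ (x ∙ t) u ∙ δ x t  ≈⟨ ∙-congʳ hyp ⟩
      δ x u ∙ δ x t        ≈⟨ comm _ _ ⟩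
      δ x t ∙ δ x u        ∎)

    module _ {p : Level} {S : Pred Carrier p} (S-size : HasSize2 G S)
             (S-inv : InvClosed G S) (_≟_ : Decidable _≈_)
             (δ-S : ∀ x {t} → S t → S (δ x t)) where
      open Pair S-size

      δ-shift-invariant-at-inverse : ∀ x {u} → S u → δ (x ∙ u) (u ⁻¹) ≈ δ x (u ⁻¹)
      δ-shift-invariant-at-inverse x Su = trans (δ-inverse x _)
        (sym (injection-commutes-with-⁻¹ S-inv _≟_ (δ x) (δ-cong refl) δ-injective (δ-S x) Su))

      -- δ (x ∙ u) and δ x are injections of the two-element set S agreeing at u ⁻¹.
      δ-shift-invariant : ∀ x {t u} → S t → S u → δ (x ∙ u) t ≈ δ x t
      δ-shift-invariant x {t} {u} St Su with t ≟ (u ⁻¹)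
      ... | yes t≈u⁻¹ = begin
        δ (x ∙ u) t       ≈⟨ δ-cong refl t≈u⁻¹ ⟩
        δ (x ∙ u) (u ⁻¹)  ≈⟨ δ-shift-invariant-at-inverse x Su ⟩
        δ x (u ⁻¹)        ≈⟨ δ-cong refl t≈u⁻¹ ⟨
        δ x t             ∎
      ... | no t≉u⁻¹ = S-pigeonhole (δ-S (x ∙ u) St) (δ-S x St) (δ-S x (S-inv u Su))
        (λ e → t≉u⁻¹ (δ-injective (trans e (sym (δ-shift-invariant-at-inverse x Su)))))
        (t≉u⁻¹ ∘ δ-injective)

  module Graph {p : Level} {R L : Pred Carrier p}
               (R-size : HasSize2 G R) (L-size : HasSize1 G L) where
    open SC G R L
    open Pair R-size using ()
      renaming (A to a; B to b; A≉B to a≉b; S-A to Ra; S-B to Rb; S-resp to R-resp)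

    vertexSetoid : Setoid c ℓ
    vertexSetoid = ×-setoid setoid (≡.setoid Layer)

    open Setoid vertexSetoid using () renaming (sym to ≈ᵥ-sym; trans to ≈ᵥ-trans)

    private
      l : Carrier
      l = proj₁ L-size

    L⇒≈l : ∀ {x} → L x → x ≈ l
    L⇒≈l {x} = Equivalence.to (proj₂ L-size x)

    L-resp : ∀ {x y} → x ≈ y → L x → L y
    L-resp {y = y} x≈y Lx = Equivalence.from (proj₂ L-size y) (trans (sym x≈y) (L⇒≈l Lx))

    Conn : Layer → Pred Carrier p
    Conn one = R
    Conn two = L

    Conn-resp : ∀ i {x y} → x ≈ y → Conn i x → Conn i y
    Conn-resp one = R-resp
    Conn-resp two = L-resp

    Adj-layer⇒Conn : ∀ i {x y} → Adj (x , i) (y , i) → Conn i (y ∙ x ⁻¹)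
    Adj-layer⇒Conn one = lower
    Adj-layer⇒Conn two = lower

    Conn⇒Adj-layer : ∀ i {x y} → Conn i (y ∙ x ⁻¹) → Adj (x , i) (y , i)
    Conn⇒Adj-layer one = lift
    Conn⇒Adj-layer two = lift

    Adj-translate : ∀ i x {t} → Conn i t → Adj (x , i) (x ∙ t , i)
    Adj-translate i x Ct = Conn⇒Adj-layer i (Conn-resp i (sym (xyx⁻¹≈y x _)) Ct)

    Adj-resp : ∀ {u u′ v v′} → u ≈ᵥ u′ → v ≈ᵥ v′ → Adj u v → Adj u′ v′
    Adj-resp {_ , one} {_ , .one} {_ , one} {_ , .one} (e , ≡.refl) (f , ≡.refl) (lift r) =
      lift (R-resp (∙-cong f (⁻¹-cong e)) r)
    Adj-resp {_ , two} {_ , .two} {_ , two} {_ , .two} (e , ≡.refl) (f , ≡.refl) (lift r) =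
      lift (L-resp (∙-cong f (⁻¹-cong e)) r)
    Adj-resp {_ , one} {_ , .one} {_ , two} {_ , .two} (e , ≡.refl) (f , ≡.refl) (lift r) =
      lift (trans (sym e) (trans r f))
    Adj-resp {_ , two} {_ , .two} {_ , one} {_ , .one} (e , ≡.refl) (f , ≡.refl) (lift r) =
      lift (trans (sym e) (trans r f))

    layer-two-neighbours : ∀ y {v} → Adj (y , two) v → v ≈ᵥ (y , one) ⊎ v ≈ᵥ (l ∙ y , two)
    layer-two-neighbours y {z , one} (lift y≈z) = inj₁ (sym y≈z , ≡.refl)
    layer-two-neighbours y {z , two} (lift Lzy⁻¹) =
      inj₂ (trans (sym (//-rightDividesˡ y z)) (∙-congʳ (L⇒≈l Lzy⁻¹)) , ≡.refl)

    three-distinct-neighbours⇒layer-one : ∀ w {v₁ v₂ v₃} →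
      Adj w v₁ → Adj w v₂ → Adj w v₃ → ¬ v₁ ≈ᵥ v₂ → ¬ v₁ ≈ᵥ v₃ → ¬ v₂ ≈ᵥ v₃ → proj₂ w ≡.≡ one
    three-distinct-neighbours⇒layer-one (_ , one) _ _ _ _ _ _ = ≡.refl
    three-distinct-neighbours⇒layer-one (y , two) a₁ a₂ a₃ v₁≉v₂ v₁≉v₃ v₂≉v₃ =
      ⊥-elim (v₁≉v₂ (pair-pigeonhole vertexSetoid
        (layer-two-neighbours y a₁) (layer-two-neighbours y a₂) (layer-two-neighbours y a₃)
        v₁≉v₃ v₂≉v₃))

    one≢two : ¬ one ≡.≡ two
    one≢two ()

    layer-one-preserved : (f : Vertex → Vertex) → (∀ {u v} → f u ≈ᵥ f v → u ≈ᵥ v) →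
      (∀ {u v} → Adj u v → Adj (f u) (f v)) → ∀ x → proj₂ (f (x , one)) ≡.≡ one
    layer-one-preserved f f-inj f-adj x =
      three-distinct-neighbours⇒layer-one (f (x , one))
        (f-adj (Adj-translate one x Ra)) (f-adj (Adj-translate one x Rb)) (f-adj (lift refl))
        (λ e → a≉b (∙-cancelˡ x a b (proj₁ (f-inj e))))
        (one≢two ∘ proj₂ ∘ f-inj) (one≢two ∘ proj₂ ∘ f-inj)

    module Automorphic (σ : Automorphism) where
      open Automorphism σ

      to-injective : ∀ {u v} → to u ≈ᵥ to v → u ≈ᵥ v
      to-injective {u} {v} e = ≈ᵥ-trans (≈ᵥ-sym (from-to u)) (≈ᵥ-trans (from-cong e) (from-to v))

      from-injective : ∀ {u v} → from u ≈ᵥ from v → u ≈ᵥ v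
      from-injective {u} {v} e = ≈ᵥ-trans (≈ᵥ-sym (to-from u)) (≈ᵥ-trans (to-cong e) (to-from v))

      from-adj : ∀ {u v} → Adj u v → Adj (from u) (from v)
      from-adj {u} {v} = adj-refl _ _ ∘ Adj-resp (≈ᵥ-sym (to-from u)) (≈ᵥ-sym (to-from v))

      to-layer : ∀ x i → proj₂ (to (x , i)) ≡.≡ i
      to-layer x one = layer-one-preserved to to-injective (adj-pres _ _) x
      to-layer x two with to (x , two) in eq
      ... | _ , two = ≡.refl
      ... | y , one = ⊥-elim (one≢two (≡.trans
        (≡.sym (layer-one-preserved from from-injective from-adj y))
        (proj₂ (≡.subst (λ v → from v ≈ᵥ (x , two)) eq (from-to (x , two))))))

      s : Carrier → Carrier
      s x = proj₁ (to (x , one))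

      to≈ : ∀ x i → to (x , i) ≈ᵥ (s x , i)
      to≈ x one = refl , to-layer x one
      to≈ x two = sym (lower matching-edge) , to-layer x two
        where
          matching-edge : Adj (s x , one) (proj₁ (to (x , two)) , two)
          matching-edge = Adj-resp (to≈ x one) (refl , to-layer x two) (adj-pres _ _ (lift refl))

      s-cong : ∀ {x y} → x ≈ y → s x ≈ s y
      s-cong x≈y = proj₁ (to-cong (x≈y , ≡.refl))

      s-injective : ∀ {x y} → s x ≈ s y → x ≈ y
      s-injective {x} {y} e =
        proj₁ (to-injective (≈ᵥ-trans (to≈ x one) (≈ᵥ-trans (e , ≡.refl) (≈ᵥ-sym (to≈ y one)))))

      open Difference s s-cong s-injective public

      δ-Conn : ∀ i x {t} → Conn i t → Conn i (δ x t)
      δ-Conn i x {t} Ct =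
        Adj-layer⇒Conn i (Adj-resp (to≈ x i) (to≈ (x ∙ t) i) (adj-pres _ _ (Adj-translate i x Ct)))

      conjugate-translation : ∀ {g h} → (∀ x → s (x ∙ g) ≈ s x ∙ h) →
                              ∀ v → to (ρ g (from v)) ≈ᵥ ρ h v
      conjugate-translation {g} hyp (y , i) =
        ≈ᵥ-trans (to≈ (x ∙ g) j) (trans (hyp x) (∙-congʳ (proj₁ sx≈y)) , proj₂ sx≈y)
        where
          x : Carrier
          x = proj₁ (from (y , i))
          j : Layer
          j = proj₂ (from (y , i))
          sx≈y : (s x , j) ≈ᵥ (y , i)
          sx≈y = ≈ᵥ-trans (≈ᵥ-sym (to≈ x j)) (to-from (y , i))

    module _ (connected : Connected) where

      generated-induction : ∀ {q} (P : Pred Carrier q) → (∀ {x y} → x ≈ y → P x → P y) →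
        (∀ {u z} → (R ∪ L) u → P z → P (u ∙ z)) → ∀ {x} → P x → ∀ y → P y
      generated-induction P P-resp P-step {x} Px y = along (connected (x , one) (y , one)) Px
        where
          across : ∀ {v w} → Adj v w → P (proj₁ v) → P (proj₁ w)
          across {z , one} {y , one} (lift r) = P-resp (//-rightDividesˡ z y) ∘ P-step (inj₁ r)
          across {z , two} {y , two} (lift r) = P-resp (//-rightDividesˡ z y) ∘ P-step (inj₂ r)
          across {_ , one} {_ , two} (lift e) = P-resp e
          across {_ , two} {_ , one} (lift e) = P-resp e

          along : ∀ {v w} → Walk v w → P (proj₁ v) → P (proj₁ w)
          along (here (e , _)) = P-resp e
          along (step a w)     = along w ∘ across a

      module _ (R-inv : InvClosed G R) (_≟_ : Decidable _≈_) (σ : Automorphism) where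
        open Automorphic σ

        δ-L : ∀ x {t} → L t → δ x t ≈ l
        δ-L x = L⇒≈l ∘ δ-Conn two x

        δ-local : ∀ x {t u} → (R ∪ L) t → (R ∪ L) u → δ (x ∙ u) t ≈ δ x t
        δ-local x (inj₂ Lt) _          = trans (δ-L _ Lt) (sym (δ-L x Lt))
        δ-local x (inj₁ Rt) (inj₂ Lu) = δ-swap (trans (δ-L _ Lu) (sym (δ-L x Lu)))
        δ-local x (inj₁ Rt) (inj₁ Ru) = δ-shift-invariant R-size R-inv _≟_ (δ-Conn one) x Rt Ru

        δ-generator-invariant : ∀ {t} → (R ∪ L) t → ∀ x y → δ y t ≈ δ x t
        δ-generator-invariant gt x = generated-induction (λ z → δ z _ ≈ δ x _)
          (λ e → trans (δ-cong (sym e) refl))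
          (λ {u} {z} gu → trans (trans (δ-cong (comm u z) refl) (δ-local z gt gu)))
          refl

        δ-invariant : ∀ g x → δ x g ≈ δ ε g
        δ-invariant g = generated-induction (λ z → δ z g ≈ δ ε g)
          (λ e → trans (δ-cong (sym e) refl))
          (λ {u} {z} gu → trans (trans (δ-cong (comm u z) refl)
                                       (δ-swap (δ-generator-invariant gu z (z ∙ g)))))
          refl

lemma3p5 : {c ℓ p : Level} (G : AbelianGroup c ℓ) (R L : Pred (AbelianGroup.Carrier G) p) →
    IsFinite G → Nontrivial G →
    InvClosed G R → InvClosed G L →
    ¬ R (AbelianGroup.ε G) → ¬ L (AbelianGroup.ε G) →
    HasSize2 G R → HasSize1 G L →
    SC.Connected G R L →
    SC.Normal G R L
lemma3p5 G R L (_ , _≟_) _ R-inv _ _ _ R-size L-size connected σ g =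
  δ ε g , conjugate-translation translation
  where
    open AbelianGroup G
    open Graph G R-size L-size
    open Automorphic σ

    translation : ∀ x → s (x ∙ g) ≈ s x ∙ δ ε g
    translation x = trans (δ-split x g)
      (trans (∙-congʳ (δ-invariant connected R-inv _≟_ σ g x)) (comm _ _))
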